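{- Let $n\ge1$ and let $X$ be an $L$-algebra whose underlying set is $L_n=\{x_0,\dots,x_{n-1}\}$ and whose natural order is the total order $x_0>x_1>\dots>x_{n-1}$. Let $p$ be the smallest invariant element of $X$. Let $L_{n+1}=\{x_0,\dots,x_n\}\supseteq L_n$ be totally ordered by $x_0>x_1>\dots>x_n$, and let $c\in L_{n+1}$ satisfy $p\cdot x_{n-1}>c$. Then there is a unique $L$-algebra $X'$ with underlying set $L_{n+1}$ whose natural order is the given total order on $L_{n+1}$, such that the inclusion $L_n\hookrightarrow L_{n+1}$ embeds $X$ as a sub-$L$-algebra of $X'$ (i.e. the operation of $X'$ restricts to that of $X$ on $L_n$), and such that $p\cdot x_n=c$ in $X'$.
   Context: An $L$-algebra is a set $X$ together with a binary operation $(x,y)\mapsto x\cdot y$ such that: (i) there exists $e\in X$ with $e\cdot x=x$ and $x\cdot e=x\cdot x=e$ for all $x\in X$; (ii) $(x\cdot y)\cdot(x\cdot z)=(y\cdot x)\cdot(y\cdot z)$ for all $x,y,z\in X$; (iii) if $x\cdot y=y\cdot x=e$, then $x=y$. The element $e$ is the logical unit. The natural order is the partial order $x\le y\iff x\cdot y=e$ (so $e$ is the greatest element; here $e=x_0$). An element $x\in X$ is invariant if $y\cdot x=x$ for all $y\in X$ with $y>x$ (in particular $e$ is invariant). -}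

module Defs where

open import Data.Nat using (ℕ; suc; _≤_; _<_)
open import Data.Fin using (Fin; zero; toℕ; inject₁; fromℕ)
open import Data.Product using (Σ; _×_)
open import Relation.Binary.PropositionalEquality using (_≡_; _≢_)

-- A binary operation on the finite carrier L_k = {x_0,…,x_{k-1}} (x_i = i : Fin k).
Op : ℕ → Set
Op k = Fin k → Fin k → Fin k

record IsLAlgebra {k : ℕ} (_·_ : Op k) (e : Fin k) : Set where
  field
    unit-left  : ∀ x → e · x ≡ x
    unit-right : ∀ x → x · e ≡ e
    self       : ∀ x → x · x ≡ e
    cycloid    : ∀ x y z → (x · y) · (x · z) ≡ (y · x) · (y · z)
    antisym    : ∀ x y → x · y ≡ e → y · x ≡ e → x ≡ y

_≤[_]_ : {k : ℕ} → Fin (suc k) → Op (suc k) → Fin (suc k) → Set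
x ≤[ op ] y = op x y ≡ zero

_<[_]_ : {k : ℕ} → Fin (suc k) → Op (suc k) → Fin (suc k) → Set
x <[ op ] y = (x ≤[ op ] y) × (x ≢ y)

-- The natural order coincides with the total order x_0 > x_1 > … > x_{k-1},
-- i.e. x_i ≤ x_j iff j ≤ i.
NaturalOrderIsChain : {k : ℕ} → Op (suc k) → Set
NaturalOrderIsChain op =
  ∀ i j → ((i ≤[ op ] j) → toℕ j ≤ toℕ i) × (toℕ j ≤ toℕ i → (i ≤[ op ] j))

IsChainLAlgebra : {k : ℕ} → Op (suc k) → Set
IsChainLAlgebra op = IsLAlgebra op zero × NaturalOrderIsChain op

Invariant : {k : ℕ} → Op (suc k) → Fin (suc k) → Set
Invariant op x = ∀ y → x <[ op ] y → op y x ≡ x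

SmallestInvariant : {k : ℕ} → Op (suc k) → Fin (suc k) → Set
SmallestInvariant op p = Invariant op p × (∀ q → Invariant op q → p ≤[ op ] q)

Extends : {n : ℕ} → Op n → Op (suc n) → Set
Extends op op' = ∀ i j → op' (inject₁ i) (inject₁ j) ≡ inject₁ (op i j)

-- In a chain L-algebra left multiplication is monotone and inflationary, and for
-- a ≤ p the cycloid law with p gives a·b = (p·a)·(p·b); minimality of the invariant
-- element p forces p·a > a for every a < p.  An extension X' of X is determined by its
-- last column i ↦ x_i·x_n, and the cycloid law with p pins that column down: it is x_n
-- above p (this is where p·x_{n-1} < c is used) and (p·x_i)·c at and below p, which
-- determines it by induction along x_i < p·x_i.  Conversely, the column so defined
-- (constantly x_n when c = x_n) satisfies the remaining cycloid equations.

module Submission where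

open import Defs
open import Data.Nat as ℕ using (ℕ; suc; z≤n)
open import Data.Empty using (⊥-elim)
import Data.Nat.Properties as ℕ
open import Data.Fin using (Fin; zero; toℕ; inject₁; fromℕ; _≤_; _<_; _≥_; _>_)
open import Data.Fin.Properties
  using (≤-refl; ≤-antisym; _≤?_; _<?_; <-cmp; ≤∧≢⇒<; ≤fromℕ;
         toℕ-inject₁; inject₁-injective; fromℕ≢inject₁)
open import Function using (_∘_)
open import Data.Fin.Induction using (>-wellFounded; <-wellFounded)
open import Induction.WellFounded using (Acc; acc)
open import Data.Fin.Relation.Unary.Top using (view; ‵fromℕ; ‵inject₁; view-fromℕ; view-inject₁)
open import Data.Product using (Σ; _×_; _,_; proj₁; proj₂)
open import Data.Sum using (inj₁; inj₂)
open import Relation.Nullary using (¬_; yes; no; contradiction)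
open import Relation.Binary using (tri<; tri≈; tri>)
open import Relation.Binary.PropositionalEquality

-- Fin's order is the index order, the reverse of the natural order:
-- x ≤ y in the L-algebra iff y ≤ x in Fin.
module Chain {k : ℕ} {_·_ : Op (suc k)} (chain : NaturalOrderIsChain _·_) where

  ·≡zero⇒≥ : ∀ {x y} → x · y ≡ zero → x ≥ y
  ·≡zero⇒≥ {x} {y} = proj₁ (chain x y)

  ≥⇒·≡zero : ∀ {x y} → x ≥ y → x · y ≡ zero
  ≥⇒·≡zero {x} {y} = proj₂ (chain x y)

  isChainLAlgebra : (∀ x → zero · x ≡ x) →
                    (∀ x y z → (x · y) · (x · z) ≡ (y · x) · (y · z)) →
                    IsChainLAlgebra _·_
  isChainLAlgebra identityˡ cycloid = record
    { unit-left  = identityˡ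
    ; unit-right = λ x → ≥⇒·≡zero z≤n
    ; self       = λ x → ≥⇒·≡zero (≤-refl {x = x})
    ; cycloid    = cycloid
    ; antisym    = λ x y x·y≡0 y·x≡0 → ≤-antisym (·≡zero⇒≥ y·x≡0) (·≡zero⇒≥ x·y≡0)
    } , chain

module ChainLAlgebra {m : ℕ} {_·_ : Op (suc m)} (isChain : IsChainLAlgebra _·_) where
  open IsLAlgebra (proj₁ isChain) public
  open Chain (proj₂ isChain) public using (·≡zero⇒≥; ≥⇒·≡zero)

  ·-monoʳ-≤ : ∀ x {a b} → a ≤ b → x · a ≤ x · b
  ·-monoʳ-≤ x {a} {b} a≤b = ·≡zero⇒≥ (begin
    (x · b) · (x · a) ≡⟨ cycloid x b a ⟩
    (b · x) · (b · a) ≡⟨ cong ((b · x) ·_) (≥⇒·≡zero a≤b) ⟩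
    (b · x) · zero    ≡⟨ unit-right (b · x) ⟩
    zero              ∎)
    where open ≡-Reasoning

  <[·]⇒> : ∀ {x y} → x <[ _·_ ] y → y < x
  <[·]⇒> (x·y≡0 , x≢y) = ≤∧≢⇒< (·≡zero⇒≥ x·y≡0) (x≢y ∘ sym)

  x·y≤y : ∀ x y → x · y ≤ y
  x·y≤y x y = go y (>-wellFounded y)
    where
    go : ∀ y → Acc _>_ y → x · y ≤ y
    go y (acc rec) with (x · y) ≤? y
    ... | yes done = done
    ... | no x·y≰y = contradiction (·≡zero⇒≥ y·w≡0) (ℕ.<⇒≱ y<w)
      where
      w = x · y
      y<w : y < w
      y<w = ℕ.≰⇒> x·y≰y
      x<y : x < y
      x<y = ℕ.≰⇒> λ y≤x → ℕ.<⇒≱ y<w (subst (_≤ y) (sym (≥⇒·≡zero y≤x)) z≤n)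
      x·w≡w : x · w ≡ w
      x·w≡w = ≤-antisym (go w (rec y<w)) (·-monoʳ-≤ x (ℕ.<⇒≤ y<w))
      y·w≡0 : y · w ≡ zero
      y·w≡0 = begin
        y · w             ≡⟨ unit-left (y · w) ⟨
        zero · (y · w)    ≡⟨ cong (_· (y · w)) (≥⇒·≡zero (ℕ.<⇒≤ x<y)) ⟨
        (y · x) · (y · w) ≡⟨ cycloid x y w ⟨
        w · (x · w)       ≡⟨ cong (w ·_) x·w≡w ⟩
        w · w             ≡⟨ self w ⟩
        zero              ∎
        where open ≡-Reasoning

  module SmallestInvariantProperties {p : Fin (suc m)} (p-smallest : SmallestInvariant _·_ p) where

    ·-via-p : ∀ {a} b → p ≤ a → a · b ≡ (p · a) · (p · b)
    ·-via-p {a} b p≤a = begin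
      a · b             ≡⟨ unit-left (a · b) ⟨
      zero · (a · b)    ≡⟨ cong (_· (a · b)) (≥⇒·≡zero p≤a) ⟨
      (a · p) · (a · b) ≡⟨ cycloid p a b ⟨
      (p · a) · (p · b) ∎
      where open ≡-Reasoning

    p·-injective : ∀ {a b} → p ≤ a → p ≤ b → p · a ≡ p · b → a ≡ b
    p·-injective {a} {b} p≤a p≤b p·a≡p·b = antisym a b
      (trans (·-via-p b p≤a) (trans (cong ((p · a) ·_) (sym p·a≡p·b)) (self (p · a))))
      (trans (·-via-p a p≤b) (trans (cong ((p · b) ·_) p·a≡p·b) (self (p · b))))

    x·p≡p : ∀ {x} → x < p → x · p ≡ p
    x·p≡p {x} x<p =
      proj₁ p-smallest x (≥⇒·≡zero (ℕ.<⇒≤ x<p) , λ p≡x → ℕ.<-irrefl (cong toℕ (sym p≡x)) x<p)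

    x·y≡y : ∀ {x y} → x < p → p ≤ y → x · y ≡ y
    x·y≡y {x} {y} x<p p≤y = p·-injective p≤x·y p≤y (begin
      p · (x · y)       ≡⟨ cong (_· (x · y)) (x·p≡p x<p) ⟨
      (x · p) · (x · y) ≡⟨ cycloid x p y ⟩
      (p · x) · (p · y) ≡⟨ cong (_· (p · y)) (≥⇒·≡zero (ℕ.<⇒≤ x<p)) ⟩
      zero · (p · y)    ≡⟨ unit-left (p · y) ⟩
      p · y             ∎)
      where
      open ≡-Reasoning
      p≤x·y : p ≤ x · y
      p≤x·y = subst (_≤ x · y) (x·p≡p x<p) (·-monoʳ-≤ x p≤y)

    not-invariant : ∀ {z} → p < z → ¬ Invariant _·_ z
    not-invariant p<z z-invariant = ℕ.<⇒≱ p<z (·≡zero⇒≥ (proj₂ p-smallest _ z-invariant))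

    -- A fixed point w of p·_ at or below p is absorbed by every z above it, hence invariant;
    -- the recursion passes from z < p to p·z, which lies strictly higher.
    fixed-absorbs : ∀ z → Acc _<_ z → ∀ {w} → z < w → p ≤ w → p · w ≡ w → z · w ≡ w
    fixed-absorbs z (acc rec) {w} z<w p≤w p·w≡w with <-cmp z p
    ... | tri< z<p _ _ = x·y≡y z<p p≤w
    ... | tri≈ _ refl _ = p·w≡w
    ... | tri> _ _ p<z = begin
      z · w             ≡⟨ ·-via-p w (ℕ.<⇒≤ p<z) ⟩
      (p · z) · (p · w) ≡⟨ cong ((p · z) ·_) p·w≡w ⟩
      (p · z) · w       ≡⟨ fixed-absorbs (p · z) (rec p·z<z) (ℕ.<-trans p·z<z z<w) p≤w p·w≡w ⟩
      w                 ∎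
      where
      open ≡-Reasoning
      p·z<z : p · z < z
      p·z<z = ≤∧≢⇒< (x·y≤y p z) λ p·z≡z → not-invariant p<z λ y z<[·]y →
        fixed-absorbs y (rec (<[·]⇒> z<[·]y)) (<[·]⇒> z<[·]y) (ℕ.<⇒≤ p<z) p·z≡z

    p·w<w : ∀ {w} → p < w → p · w < w
    p·w<w {w} p<w = ≤∧≢⇒< (x·y≤y p w) λ p·w≡w → not-invariant p<w λ y w<[·]y →
      fixed-absorbs y (<-wellFounded y) (<[·]⇒> w<[·]y) (ℕ.<⇒≤ p<w) p·w≡w

inject₁-mono-≤ : ∀ {n} {i j : Fin n} → i ≤ j → inject₁ i ≤ inject₁ j
inject₁-mono-≤ {i = i} {j} = subst₂ ℕ._≤_ (sym (toℕ-inject₁ i)) (sym (toℕ-inject₁ j))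

inject₁-cancel-≤ : ∀ {n} {i j : Fin n} → inject₁ i ≤ inject₁ j → i ≤ j
inject₁-cancel-≤ {i = i} {j} = subst₂ ℕ._≤_ (toℕ-inject₁ i) (toℕ-inject₁ j)

lastColumn : ∀ {m} → Op (suc (suc m)) → Fin (suc m) → Fin (suc (suc m))
lastColumn {m} _·′_ i = inject₁ i ·′ fromℕ (suc m)

module ExtensionByColumn {m : ℕ} {_·_ : Op (suc m)} (isChain : IsChainLAlgebra _·_)
                         (col : Fin (suc m) → Fin (suc (suc m))) where
  open ChainLAlgebra isChain

  xₙ : Fin (suc (suc m))
  xₙ = fromℕ (suc m)

  -- Opaque, so that goals see _·′_ only through the three equations below.
  opaque
    _·′_ : Op (suc (suc m))
    x ·′ y with view x | view y
    ... | ‵fromℕ     | _          = zero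
    ... | ‵inject₁ i | ‵fromℕ     = col i
    ... | ‵inject₁ i | ‵inject₁ j = inject₁ (i · j)

    ·′-extends : Extends _·_ _·′_
    ·′-extends i j rewrite view-inject₁ i | view-inject₁ j = refl

    xₙ·′ : ∀ y → xₙ ·′ y ≡ zero
    xₙ·′ y rewrite view-fromℕ (suc m) = refl

    ·′-column : ∀ i → inject₁ i ·′ xₙ ≡ col i
    ·′-column i rewrite view-inject₁ i | view-fromℕ (suc m) = refl

  ·′-chain : (∀ i → col i ≢ zero) → NaturalOrderIsChain _·′_
  ·′-chain col≢zero x y with view x | view y
  ... | ‵fromℕ     | _          = (λ _ → ≤fromℕ y) , (λ _ → xₙ·′ y)
  ... | ‵inject₁ i | ‵fromℕ     =
        (λ i·′xₙ≡0 → ⊥-elim (col≢zero i (trans (sym (·′-column i)) i·′xₙ≡0))) ,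
        (λ xₙ≤i → ⊥-elim (fromℕ≢inject₁ (≤-antisym xₙ≤i (≤fromℕ (inject₁ i)))))
  ... | ‵inject₁ i | ‵inject₁ j =
        (λ i·′j≡0 → inject₁-mono-≤ (·≡zero⇒≥ (inject₁-injective (trans (sym (·′-extends i j)) i·′j≡0)))) ,
        (λ j≤i → trans (·′-extends i j) (cong inject₁ (≥⇒·≡zero (inject₁-cancel-≤ j≤i))))

  ·′-identityˡ : col zero ≡ xₙ → ∀ x → zero ·′ x ≡ x
  ·′-identityˡ col-zero x with view x
  ... | ‵fromℕ     = trans (·′-column zero) col-zero
  ... | ‵inject₁ j = trans (·′-extends zero j) (cong inject₁ (unit-left j))

  ·′-isChainLAlgebra : (∀ i → col i ≢ zero) → col zero ≡ xₙ →
                       (∀ i j → inject₁ (i · j) ≤ col i) →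
                       (∀ i j → inject₁ (i · j) ·′ col i ≡ inject₁ (j · i) ·′ col j) →
                       IsChainLAlgebra _·′_
  ·′-isChainLAlgebra col≢zero col-zero col-bound col-cycloid =
    isChainLAlgebra (·′-identityˡ col-zero) cycloid′
    where
    open Chain (·′-chain col≢zero) using (isChainLAlgebra) renaming (≥⇒·≡zero to ≥⇒·′≡zero)

    y·′z≤y·′xₙ : ∀ y z → y ·′ z ≤ y ·′ xₙ
    y·′z≤y·′xₙ y z with view y | view z
    ... | ‵fromℕ     | _          = subst (_≤ xₙ ·′ xₙ) (sym (xₙ·′ z)) z≤n
    ... | ‵inject₁ i | ‵fromℕ     = ≤-refl
    ... | ‵inject₁ i | ‵inject₁ j =
          subst₂ _≤_ (sym (·′-extends i j)) (sym (·′-column i)) (col-bound i j)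

    xₙ-cycloid : ∀ y z → (xₙ ·′ y) ·′ (xₙ ·′ z) ≡ (y ·′ xₙ) ·′ (y ·′ z)
    xₙ-cycloid y z = begin
      (xₙ ·′ y) ·′ (xₙ ·′ z) ≡⟨ cong₂ _·′_ (xₙ·′ y) (xₙ·′ z) ⟩
      zero ·′ zero           ≡⟨ ≥⇒·′≡zero z≤n ⟩
      zero                   ≡⟨ ≥⇒·′≡zero (y·′z≤y·′xₙ y z) ⟨
      (y ·′ xₙ) ·′ (y ·′ z)  ∎
      where open ≡-Reasoning

    cycloid′ : ∀ x y z → (x ·′ y) ·′ (x ·′ z) ≡ (y ·′ x) ·′ (y ·′ z)
    cycloid′ x y z with view x | view y | view z
    ... | ‵fromℕ     | _          | _          = xₙ-cycloid y z
    ... | ‵inject₁ i | ‵fromℕ     | _          = sym (xₙ-cycloid (inject₁ i) z)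
    ... | ‵inject₁ i | ‵inject₁ j | ‵fromℕ     = begin
      (inject₁ i ·′ inject₁ j) ·′ (inject₁ i ·′ xₙ) ≡⟨ cong₂ _·′_ (·′-extends i j) (·′-column i) ⟩
      inject₁ (i · j) ·′ col i                     ≡⟨ col-cycloid i j ⟩
      inject₁ (j · i) ·′ col j                     ≡⟨ cong₂ _·′_ (·′-extends j i) (·′-column j) ⟨
      (inject₁ j ·′ inject₁ i) ·′ (inject₁ j ·′ xₙ) ∎
      where open ≡-Reasoning
    ... | ‵inject₁ i | ‵inject₁ j | ‵inject₁ k = begin
      (inject₁ i ·′ inject₁ j) ·′ (inject₁ i ·′ inject₁ k) ≡⟨ cong₂ _·′_ (·′-extends i j) (·′-extends i k) ⟩
      inject₁ (i · j) ·′ inject₁ (i · k)                   ≡⟨ ·′-extends (i · j) (i · k) ⟩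
      inject₁ ((i · j) · (i · k))                          ≡⟨ cong inject₁ (cycloid i j k) ⟩
      inject₁ ((j · i) · (j · k))                          ≡⟨ ·′-extends (j · i) (j · k) ⟨
      inject₁ (j · i) ·′ inject₁ (j · k)                   ≡⟨ cong₂ _·′_ (·′-extends j i) (·′-extends j k) ⟨
      (inject₁ j ·′ inject₁ i) ·′ (inject₁ j ·′ inject₁ k) ∎
      where open ≡-Reasoning


module _ {m : ℕ} {_·_ : Op (suc m)} where

  row-determined-by-lastColumn : ∀ {_·′_ _·″_} → Extends _·_ _·′_ → Extends _·_ _·″_ →
                   ∀ {y} → lastColumn _·′_ y ≡ lastColumn _·″_ y → ∀ z → inject₁ y ·′ z ≡ inject₁ y ·″ z
  row-determined-by-lastColumn extends′ extends″ {y} column-y z with view z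
  ... | ‵fromℕ     = column-y
  ... | ‵inject₁ j = trans (extends′ y j) (sym (extends″ y j))

  determined-by-lastColumn : ∀ {_·′_ _·″_} →
                             IsChainLAlgebra _·′_ → Extends _·_ _·′_ →
                             IsChainLAlgebra _·″_ → Extends _·_ _·″_ →
                             (∀ i → lastColumn _·′_ i ≡ lastColumn _·″_ i) → ∀ x y → x ·′ y ≡ x ·″ y
  determined-by-lastColumn {_·′_} {_·″_} isChain′ extends′ isChain″ extends″ columns x y with view x
  ... | ‵fromℕ     = trans (Chain.≥⇒·≡zero (proj₂ isChain′) (≤fromℕ y))
                           (sym (Chain.≥⇒·≡zero (proj₂ isChain″) (≤fromℕ y)))
  ... | ‵inject₁ i = row-determined-by-lastColumn {_·′_ = _·′_} {_·″_} extends′ extends″ (columns i) y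

module LastColumn {m : ℕ} {_·_ : Op (suc m)} (isChain : IsChainLAlgebra _·_)
                  {p : Fin (suc m)} (p-smallest : SmallestInvariant _·_ p)
                  {_·′_ : Op (suc (suc m))} (isChain′ : IsChainLAlgebra _·′_)
                  (extends′ : Extends _·_ _·′_) where
  open ChainLAlgebra isChain
  open SmallestInvariantProperties p-smallest
  open IsLAlgebra (proj₁ isChain′) using () renaming (cycloid to cycloid′; unit-left to unit-left′)

  xₙ : Fin (suc (suc m))
  xₙ = fromℕ (suc m)

  lastColumn-below-p : ∀ {i} → p ≤ i → lastColumn _·′_ i ≡ inject₁ (p · i) ·′ lastColumn _·′_ p
  lastColumn-below-p {i} p≤i = begin
    inject₁ i ·′ xₙ                                ≡⟨ unit-left′ (inject₁ i ·′ xₙ) ⟨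
    inject₁ zero ·′ (inject₁ i ·′ xₙ)              ≡⟨ cong (λ e → inject₁ e ·′ (inject₁ i ·′ xₙ)) (≥⇒·≡zero p≤i) ⟨
    inject₁ (i · p) ·′ (inject₁ i ·′ xₙ)           ≡⟨ cong (_·′ (inject₁ i ·′ xₙ)) (extends′ i p) ⟨
    (inject₁ i ·′ inject₁ p) ·′ (inject₁ i ·′ xₙ)  ≡⟨ cycloid′ (inject₁ p) (inject₁ i) xₙ ⟨
    (inject₁ p ·′ inject₁ i) ·′ (inject₁ p ·′ xₙ)  ≡⟨ cong (_·′ (inject₁ p ·′ xₙ)) (extends′ p i) ⟩
    inject₁ (p · i) ·′ (inject₁ p ·′ xₙ)           ∎
    where open ≡-Reasoning

  p·′lastColumn-above-p : ∀ {i} → i < p → inject₁ p ·′ lastColumn _·′_ i ≡ lastColumn _·′_ p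
  p·′lastColumn-above-p {i} i<p = begin
    inject₁ p ·′ (inject₁ i ·′ xₙ)                 ≡⟨ cong (λ e → inject₁ e ·′ (inject₁ i ·′ xₙ)) (x·p≡p i<p) ⟨
    inject₁ (i · p) ·′ (inject₁ i ·′ xₙ)           ≡⟨ cong (_·′ (inject₁ i ·′ xₙ)) (extends′ i p) ⟨
    (inject₁ i ·′ inject₁ p) ·′ (inject₁ i ·′ xₙ)  ≡⟨ cycloid′ (inject₁ i) (inject₁ p) xₙ ⟩
    (inject₁ p ·′ inject₁ i) ·′ (inject₁ p ·′ xₙ)  ≡⟨ cong (_·′ (inject₁ p ·′ xₙ)) (extends′ p i) ⟩
    inject₁ (p · i) ·′ (inject₁ p ·′ xₙ)           ≡⟨ cong (λ e → inject₁ e ·′ (inject₁ p ·′ xₙ))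
                                                           (≥⇒·≡zero (ℕ.<⇒≤ i<p)) ⟩
    inject₁ zero ·′ (inject₁ p ·′ xₙ)              ≡⟨ unit-left′ (inject₁ p ·′ xₙ) ⟩
    inject₁ p ·′ xₙ                                ∎
    where open ≡-Reasoning

  lastColumn-above-p : p · fromℕ m < lastColumn _·′_ p → ∀ {i} → i < p → lastColumn _·′_ i ≡ xₙ
  lastColumn-above-p p·xₘ<c {i} i<p = only-xₙ (lastColumn _·′_ i) (p·′lastColumn-above-p i<p)
    where
    only-xₙ : ∀ w → inject₁ p ·′ w ≡ lastColumn _·′_ p → w ≡ xₙ
    only-xₙ w p·′w≡c with view w
    ... | ‵fromℕ     = refl
    ... | ‵inject₁ j = contradiction (·-monoʳ-≤ p (≤fromℕ j)) (ℕ.<⇒≱ p·xₘ<p·j)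
      where
      c≡p·j : toℕ (lastColumn _·′_ p) ≡ toℕ (p · j)
      c≡p·j = trans (cong toℕ (trans (sym p·′w≡c) (extends′ p j))) (toℕ-inject₁ (p · j))
      p·xₘ<p·j : p · fromℕ m < p · j
      p·xₘ<p·j = subst (toℕ (p · fromℕ m) ℕ.<_) c≡p·j p·xₘ<c

module _ {m : ℕ} {_·_ : Op (suc m)} (isChain : IsChainLAlgebra _·_)
         {p : Fin (suc m)} (p-smallest : SmallestInvariant _·_ p) where
  open ChainLAlgebra isChain
  open SmallestInvariantProperties p-smallest

  lastColumns-agree : ∀ {_·′_ _·″_} →
                      IsChainLAlgebra _·′_ → Extends _·_ _·′_ →
                      IsChainLAlgebra _·″_ → Extends _·_ _·″_ →
                      p · fromℕ m < lastColumn _·′_ p → lastColumn _·′_ p ≡ lastColumn _·″_ p →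
                      ∀ i → lastColumn _·′_ i ≡ lastColumn _·″_ i
  lastColumns-agree {_·′_} {_·″_} isChain′ extends′ isChain″ extends″ p·xₘ<c c′≡c″ i =
    go i (<-wellFounded i)
    where
    module ′ = LastColumn isChain p-smallest isChain′ extends′
    module ″ = LastColumn isChain p-smallest isChain″ extends″

    go : ∀ i → Acc _<_ i → lastColumn _·′_ i ≡ lastColumn _·″_ i
    go i (acc rec) with <-cmp i p
    ... | tri< i<p _ _ = trans (′.lastColumn-above-p p·xₘ<c i<p)
                               (sym (″.lastColumn-above-p (subst (p · fromℕ m <_) c′≡c″ p·xₘ<c) i<p))
    ... | tri≈ _ refl _ = c′≡c″
    ... | tri> _ _ p<i = begin
      lastColumn _·′_ i                    ≡⟨ ′.lastColumn-below-p (ℕ.<⇒≤ p<i) ⟩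
      inject₁ (p · i) ·′ lastColumn _·′_ p ≡⟨ row-determined-by-lastColumn {_·′_ = _·′_} {_·″_} extends′ extends″
                                                (go (p · i) (rec (p·w<w p<i))) (lastColumn _·′_ p) ⟩
      inject₁ (p · i) ·″ lastColumn _·′_ p ≡⟨ cong (inject₁ (p · i) ·″_) c′≡c″ ⟩
      inject₁ (p · i) ·″ lastColumn _·″_ p ≡⟨ ″.lastColumn-below-p (ℕ.<⇒≤ p<i) ⟨
      lastColumn _·″_ i                    ∎
      where open ≡-Reasoning

  ChainExtension : Fin (suc (suc m)) → Set
  ChainExtension c =
    Σ (Op (suc (suc m))) λ _·′_ → IsChainLAlgebra _·′_ × Extends _·_ _·′_ × lastColumn _·′_ p ≡ c

  extension-to-xₙ : ChainExtension (fromℕ (suc m))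
  extension-to-xₙ =
    _·′_ , ·′-isChainLAlgebra (λ _ ()) refl (λ i j → ≤fromℕ _) col-cycloid , ·′-extends , ·′-column p
    where
    open ExtensionByColumn isChain (λ _ → fromℕ (suc m))
    col-cycloid : ∀ i j → inject₁ (i · j) ·′ xₙ ≡ inject₁ (j · i) ·′ xₙ
    col-cycloid i j = trans (·′-column (i · j)) (sym (·′-column (j · i)))

  extension-to-inject₁ : ∀ {c} → p · fromℕ m < c → ChainExtension (inject₁ c)
  extension-to-inject₁ {c} p·xₘ<c =
    _·′_ , ·′-isChainLAlgebra col≢zero col-zero col-bound col-cycloid , ·′-extends , p-column
    where
    -- The column forced by lastColumn-above-p and lastColumn-below-p.
    col : Fin (suc m) → Fin (suc (suc m))
    col i with i <? p
    ... | yes _ = fromℕ (suc m)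
    ... | no _  = inject₁ ((p · i) · c)

    open ExtensionByColumn isChain col

    col-above : ∀ {i} → i < p → col i ≡ xₙ
    col-above {i} i<p with i <? p
    ... | yes _   = refl
    ... | no i≮p  = contradiction i<p i≮p

    col-below : ∀ {i} → p ≤ i → col i ≡ inject₁ ((p · i) · c)
    col-below {i} p≤i with i <? p
    ... | yes i<p = contradiction p≤i (ℕ.<⇒≱ i<p)
    ... | no _    = refl

    p·y<c : ∀ y → p · y < c
    p·y<c y = ℕ.≤-<-trans (·-monoʳ-≤ p (≤fromℕ y)) p·xₘ<c

    col≢zero : ∀ i → col i ≢ zero
    col≢zero i with ℕ.<-≤-connex (toℕ i) (toℕ p)
    ... | inj₁ i<p = subst (_≢ zero) (sym (col-above i<p)) λ ()
    ... | inj₂ p≤i = λ col-i≡0 → ℕ.<⇒≱ (p·y<c i)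
                      (·≡zero⇒≥ (inject₁-injective (trans (sym (col-below p≤i)) col-i≡0)))

    col-zero : col zero ≡ xₙ
    col-zero = col-above (ℕ.≰⇒> p≰zero)
      where
      p≰zero : ¬ p ≤ zero {m}
      p≰zero p≤0 = ℕ.<⇒≱ p·xₘ<c (subst (λ q → c ≤ q · fromℕ m) (≤-antisym z≤n p≤0)
                     (subst (c ≤_) (sym (unit-left (fromℕ m))) (≤fromℕ c)))

    col-bound : ∀ i j → inject₁ (i · j) ≤ col i
    col-bound i j with ℕ.<-≤-connex (toℕ i) (toℕ p)
    ... | inj₁ i<p = subst (inject₁ (i · j) ≤_) (sym (col-above i<p)) (≤fromℕ _)
    ... | inj₂ p≤i = subst (inject₁ (i · j) ≤_) (sym (col-below p≤i)) (inject₁-mono-≤ (begin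
      toℕ (i · j)                   ≤⟨ ·-monoʳ-≤ i (≤fromℕ j) ⟩
      toℕ (i · fromℕ m)             ≡⟨ cong toℕ (·-via-p (fromℕ m) p≤i) ⟩
      toℕ ((p · i) · (p · fromℕ m)) ≤⟨ ·-monoʳ-≤ (p · i) (ℕ.<⇒≤ p·xₘ<c) ⟩
      toℕ ((p · i) · c)             ∎))
      where open ℕ.≤-Reasoning

    p-column : lastColumn _·′_ p ≡ inject₁ c
    p-column = begin
      inject₁ p ·′ xₙ       ≡⟨ ·′-column p ⟩
      col p                 ≡⟨ col-below (ℕ.≤-refl {toℕ p}) ⟩
      inject₁ ((p · p) · c) ≡⟨ cong (λ e → inject₁ (e · c)) (self p) ⟩
      inject₁ (zero · c)    ≡⟨ cong inject₁ (unit-left c) ⟩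
      inject₁ c             ∎
      where open ≡-Reasoning

    both-above : ∀ {i j} → i < p → j < p → inject₁ (i · j) ·′ col i ≡ xₙ
    both-above {i} {j} i<p j<p = trans (cong (inject₁ (i · j) ·′_) (col-above i<p))
                                       (trans (·′-column (i · j)) (col-above (ℕ.≤-<-trans (x·y≤y i j) j<p)))

    mixed : ∀ {i j} → i < p → p ≤ j → inject₁ (i · j) ·′ col i ≡ inject₁ (j · i) ·′ col j
    mixed {i} {j} i<p p≤j = begin
      inject₁ (i · j) ·′ col i ≡⟨ cong₂ (λ a b → inject₁ a ·′ b) (x·y≡y i<p p≤j) (col-above i<p) ⟩
      inject₁ j ·′ xₙ          ≡⟨ ·′-column j ⟩
      col j                    ≡⟨ ·′-identityˡ col-zero (col j) ⟨
      zero ·′ col j            ≡⟨ cong (λ a → inject₁ a ·′ col j) (≥⇒·≡zero (ℕ.≤-trans (ℕ.<⇒≤ i<p) p≤j)) ⟨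
      inject₁ (j · i) ·′ col j ∎
      where open ≡-Reasoning

    both-below : ∀ {i j} → p ≤ i → p ≤ j → inject₁ (i · j) ·′ col i ≡ inject₁ (j · i) ·′ col j
    both-below {i} {j} p≤i p≤j = begin
      inject₁ (i · j) ·′ col i                       ≡⟨ cong (inject₁ (i · j) ·′_) (col-below p≤i) ⟩
      inject₁ (i · j) ·′ inject₁ ((p · i) · c)       ≡⟨ ·′-extends (i · j) ((p · i) · c) ⟩
      inject₁ ((i · j) · ((p · i) · c))             ≡⟨ cong (λ a → inject₁ (a · ((p · i) · c))) (·-via-p j p≤i) ⟩
      inject₁ (((p · i) · (p · j)) · ((p · i) · c)) ≡⟨ cong inject₁ (cycloid (p · i) (p · j) c) ⟩
      inject₁ (((p · j) · (p · i)) · ((p · j) · c)) ≡⟨ cong (λ a → inject₁ (a · ((p · j) · c))) (·-via-p i p≤j) ⟨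
      inject₁ ((j · i) · ((p · j) · c))             ≡⟨ ·′-extends (j · i) ((p · j) · c) ⟨
      inject₁ (j · i) ·′ inject₁ ((p · j) · c)       ≡⟨ cong (inject₁ (j · i) ·′_) (col-below p≤j) ⟨
      inject₁ (j · i) ·′ col j                       ∎
      where open ≡-Reasoning

    col-cycloid : ∀ i j → inject₁ (i · j) ·′ col i ≡ inject₁ (j · i) ·′ col j
    col-cycloid i j with ℕ.<-≤-connex (toℕ i) (toℕ p) | ℕ.<-≤-connex (toℕ j) (toℕ p)
    ... | inj₁ i<p | inj₁ j<p = trans (both-above i<p j<p) (sym (both-above j<p i<p))
    ... | inj₁ i<p | inj₂ p≤j = mixed i<p p≤j
    ... | inj₂ p≤i | inj₁ j<p = sym (mixed j<p p≤i)
    ... | inj₂ p≤i | inj₂ p≤j = both-below p≤i p≤j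

  chainExtension : ∀ {c} → p · fromℕ m < c → ChainExtension c
  chainExtension {c} p·xₘ<c with view c
  ... | ‵fromℕ      = extension-to-xₙ
  ... | ‵inject₁ c′ = extension-to-inject₁ (subst (toℕ (p · fromℕ m) ℕ.<_) (toℕ-inject₁ c′) p·xₘ<c)

proposition4p4 : (m : ℕ) (op : Op (suc m)) → IsChainLAlgebra op →
    (p : Fin (suc m)) → SmallestInvariant op p →
    (c : Fin (suc (suc m))) → toℕ (op p (fromℕ m)) ℕ.< toℕ c →
    Σ (Op (suc (suc m))) (λ op' →
      (IsChainLAlgebra op' × Extends op op' × op' (inject₁ p) (fromℕ (suc m)) ≡ c)
      × ((op'' : Op (suc (suc m))) →
         IsChainLAlgebra op'' × Extends op op'' × op'' (inject₁ p) (fromℕ (suc m)) ≡ c →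
         ∀ i j → op'' i j ≡ op' i j))
proposition4p4 m _·_ isChain p p-smallest c p·xₘ<c =
  let (_·′_ , isChain′ , extends′ , p-column′) = chainExtension isChain p-smallest p·xₘ<c
  in _·′_ , (isChain′ , extends′ , p-column′) , λ _·″_ (isChain″ , extends″ , p-column″) →
       determined-by-lastColumn isChain″ extends″ isChain′ extends′
         (lastColumns-agree isChain p-smallest isChain″ extends″ isChain′ extends′
           (subst (p · fromℕ m <_) (sym p-column″) p·xₘ<c) (trans p-column″ (sym p-column′)))
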